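{- Let $G$ be a simple plane triangulation and let $v_1,\dots,v_6$ be distinct vertices of $G$ such that $d_G(v_1)=7$, $d_G(v_2)=8$, $d_G(v_3)=d_G(v_4)=d_G(v_5)=d_G(v_6)=5$, each of $v_2,\dots,v_6$ is adjacent to $v_1$, and $v_3,v_4$ are adjacent to $v_2$. Let $H$ be the subgraph of $G$ induced by $\{v_1,\dots,v_6\}$. Then the configuration $(H, d_G|_{V(H)}, \Pi_H)$ is $1/6$-reducible.
   Context: A simple plane triangulation is a simple planar graph embedded in the sphere all of whose faces are triangles; $d_G(v)$ is the degree of $v$ in $G$. A configuration in $G$ is a triple $(H, d_G|_{V(H)}, \Pi_H)$ with $H$ a connected subgraph of $G$, the $G$-degrees of its vertices, and the rotation (cyclic order of $G$-edges, non-$H$ edges as half-edges) at each vertex of $H$. For a finite graph $H$ and $\delta: V(H)\to\mathbb{Z}$, the pair $(H,\delta)$ is $0$-reducible if the vertices of $H$ can be listed $w_1,\dots,w_n$ with $\delta(w_t) - |\{s<t : w_sw_t \in E(H)\}| \le 4$ for all $t$. A configuration with $|V(H)|\ge 6$ is $1/6$-reducible if there is a sequence of distinct vertices $v'_1,\dots,v'_k$ of $H$ such that: (i) for every $i$ for which $d_G(v'_j) > \deg_H(v'_j)$ for all $j<i$, the pair $(H - v'_i, \delta_i)$ is $0$-reducible, where $\delta_i(w) = d_G(w) - [wv'_i \in E(H)] - [w \in \{v'_1,\dots,v'_{i-1}\}]$; and (ii) if $d_G(v'_j) > \deg_H(v'_j)$ for all $j\le k$, then $(H,\delta_*)$ is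 $0$-reducible, where $\delta_*(w) = d_G(w) - [w \in \{v'_1,\dots,v'_k\}]$. -}

module Defs where

open import Data.Nat as ℕ using (ℕ; zero; suc; _<_)
open import Data.Integer as ℤ using (ℤ; +_; _-_; _≤_)
open import Data.Fin using (Fin; toℕ; _≟_)
open import Data.Fin.Properties using (any?)
open import Data.List using (List; []; _∷_; length; filter; take; lookup; allFin)
open import Data.List.Relation.Unary.All using (All)
open import Data.List.Relation.Unary.Unique.Propositional using (Unique)
open import Data.List.Relation.Binary.Permutation.Propositional using (_↭_)
open import Data.List.Membership.Propositional using (_∈_)
open import Data.List.Membership.Propositional.Properties using ()
open import Data.List.Membership.DecPropositional using () renaming (_∈?_ to ∈?-gen)
open import Data.Product using (Σ; ∃; ∃-syntax; _×_; _,_)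
open import Data.Product.Properties using ()
open import Relation.Nullary using (Dec; yes; no; ¬_; ¬?)
open import Relation.Nullary.Decidable using (_×-dec_)
open import Relation.Binary.PropositionalEquality using (_≡_; _≢_)
open import Function using (_∘_)

iter : ∀ {A : Set} → (A → A) → ℕ → A → A
iter f zero    x = x
iter f (suc k) x = f (iter f k x)

-- Darts reachable from one another using the permutations σ and α
-- (both are permutations of a finite set, so forward steps suffice).
data Reach {n : ℕ} (σ α : Fin n → Fin n) (d : Fin n) : Fin n → Set where
  here  : Reach σ α d d
  stepσ : ∀ {e} → Reach σ α d e → Reach σ α d (σ e)
  stepα : ∀ {e} → Reach σ α d e → Reach σ α d (α e)

-- A simple plane triangulation, presented as a combinatorial map
-- (rotation system) of genus 0 all of whose faces are triangles.
--   * darts (half-edges) : Fin nD ; vertices : Fin nV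
--   * tail d             : the vertex at which dart d starts
--   * σ                  : rotation (next dart counterclockwise around tail d);
--                          its orbits are exactly the sets of darts at a vertex
--   * α                  : fixed-point-free involution (the other half of the edge)
--   * faces              : orbits of φ = σ ∘ α, all of length exactly 3
--   * connected, and Euler's formula V - E + F = 2 (sphere).

record SimplePlaneTriangulation : Set where
  field
    nV nD nE nF : ℕ
    tail : Fin nD → Fin nV
    σ α  : Fin nD → Fin nD
    σ-injective  : ∀ d d' → σ d ≡ σ d' → d ≡ d'
    σ-tail       : ∀ d → tail (σ d) ≡ tail d
    σ-cyclic     : ∀ d d' → tail d ≡ tail d' → ∃[ k ] iter σ k d ≡ d'
    tail-onto    : ∀ v → ∃[ d ] tail d ≡ v
    α-involution : ∀ d → α (α d) ≡ d
    α-no-fix     : ∀ d → α d ≢ d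
    face-3       : ∀ d → σ (α (σ (α (σ (α d))))) ≡ d
    face-no-fix  : ∀ d → σ (α d) ≢ d
    connected    : ∀ d d' → Reach σ α d d'
    edges        : nD ≡ 2 ℕ.* nE
    faces        : nD ≡ 3 ℕ.* nF
    euler        : nV ℕ.+ nF ≡ nE ℕ.+ 2
    no-loop      : ∀ d → tail (α d) ≢ tail d
    no-multi     : ∀ d d' → tail d ≡ tail d' → tail (α d) ≡ tail (α d') → d ≡ d'

  Vertex : Set
  Vertex = Fin nV

  deg : Vertex → ℕ
  deg v = length (filter (λ d → tail d ≟ v) (allFin nD))

  Adjacent : Vertex → Vertex → Set
  Adjacent u v = ∃[ d ] (tail d ≡ u × tail (α d) ≡ v)

  adjacent? : ∀ u v → Dec (Adjacent u v)
  adjacent? u v = any? (λ d → (tail d ≟ u) ×-dec (tail (α d) ≟ v))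

[_] : ∀ {P : Set} → Dec P → ℤ
[ yes _ ] = + 1
[ no  _ ] = + 0

module _ {k : ℕ} (A : Fin k → Fin k → Set) (A? : ∀ u v → Dec (A u v)) where

  -- (F, δ) is 0-reducible, where F is the induced subgraph on the vertices
  -- listed (without repetition) in S: the vertices of F can be listed
  -- w_1,...,w_n with δ(w_t) - |{s<t : w_s w_t ∈ E}| ≤ 4 for all t.
  ZeroReducible : List (Fin k) → (Fin k → ℤ) → Set
  ZeroReducible S δ =
    Σ (List (Fin k)) λ ws → (ws ↭ S) ×
      (∀ (t : Fin (length ws)) →
         δ (lookup ws t)
           - + length (filter (λ u → A? u (lookup ws t)) (take (toℕ t) ws))
         ≤ + 4)

  allV : List (Fin k)
  allV = allFin k

  allV-minus : Fin k → List (Fin k)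
  allV-minus v = filter (λ w → ¬? (w ≟ v)) (allFin k)

  degH : Fin k → ℕ
  degH v = length (filter (λ w → A? v w) (allFin k))

  -- 1/6-reducibility of the configuration whose graph is (Fin k, A) and whose
  -- G-degrees are given by dG.  (The rotation Π_H plays no role in the
  -- definition.)
  OneSixthReducible : (dG : Fin k → ℕ) → Set
  OneSixthReducible dG =
    Σ (List (Fin k)) λ vs → Unique vs ×
      (∀ (i : Fin (length vs)) →
         All (λ u → degH u < dG u) (take (toℕ i) vs) →
         ZeroReducible (allV-minus (lookup vs i))
           (λ w → + dG w - [ A? w (lookup vs i) ]
                         - [ ∈?-gen _≟_ w (take (toℕ i) vs) ]))
      ×
      (All (λ u → degH u < dG u) vs →
         ZeroReducible allV (λ w → + dG w - [ ∈?-gen _≟_ w vs ]))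

module _ (G : SimplePlaneTriangulation) where
  open SimplePlaneTriangulation G

  InducedConfigurationOneSixthReducible : ∀ {m} → (Fin m → Vertex) → Set
  InducedConfigurationOneSixthReducible v =
    OneSixthReducible (λ i j → Adjacent (v i) (v j))
                      (λ i j → adjacent? (v i) (v j))
                      (λ i → deg (v i))

-- v₁ has degree 7, so its rotation is a cycle of at most seven darts, four of which point to
-- v₃, …, v₆. Four pairwise non-consecutive points need a cycle of length at least 8, so two of
-- these darts are consecutive; they bound a triangular face, hence some vᵢvⱼ with 3 ≤ i < j ≤ 6
-- is an edge. The graph of H therefore contains the edges forced by the hypotheses plus one edge
-- xy, and for that smaller graph the sequence v₂, v₁, x with explicit 0-reducing orders is checked
-- by evaluation. Extra edges only lower the weights δ and raise the counts of earlier neighbours,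
-- so 1/6-reducibility passes to H.
module Submission where

open import Defs
open import Data.Fin using (Fin; #_)
open import Relation.Binary.PropositionalEquality using (_≡_)
open SimplePlaneTriangulation

open import Data.Nat as ℕ using (ℕ; zero; suc; _+_; _*_; s≤s; NonZero)
import Data.Nat.Properties as ℕ
open import Data.Nat.DivMod using (_%_; _/_; _mod_; m%n<n; m≡m%n+[m/n]*n)
open import Data.Integer as ℤ using (ℤ; +_; -_; _-_; +≤+)
import Data.Integer.Properties as ℤ
open import Data.Fin as Fin using (zero; suc; toℕ; _≟_; _↑ʳ_)
open import Data.Fin.Properties
  using (all?; any?; pigeonhole; toℕ<n; toℕ-fromℕ<; ↑ʳ-injective; ≤-decTotalOrder)
open import Data.Vec.Functional using () renaming (_∷_ to _◂_; [] to ∅)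
open import Data.List using (List; []; _∷_; _++_; length; filter; take; lookup; allFin)
open import Data.List.Properties using (≡-dec)
open import Data.List.Relation.Unary.All as All using (All; []; _∷_)
open import Data.List.Relation.Unary.Any using (index)
open import Data.List.Relation.Unary.Any.Properties using (lookup-index)
open import Data.List.Relation.Unary.Unique.Propositional using (Unique)
import Data.List.Relation.Unary.Unique.DecPropositional as UniqueDec
open import Data.List.Relation.Binary.Permutation.Propositional using (↭-sym; ↭-trans; ↭-reflexive)
open import Data.List.Relation.Binary.Sublist.Propositional using (⊆-refl)
open import Data.List.Relation.Binary.Sublist.Propositional.Properties using (filter⁺)
open import Data.List.Relation.Binary.Sublist.Heterogeneous.Properties using (length-mono-≤)
open import Data.List.Membership.Propositional using (_∈_)
open import Data.List.Membership.Propositional.Properties using (∈-filter⁺; ∈-allFin)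
import Data.List.Membership.DecPropositional
import Data.List.Sort.InsertionSort.Base
import Data.List.Sort.InsertionSort.Properties
open import Data.Product using (∃-syntax; _×_; _,_; proj₁; proj₂; uncurry)
import Data.Product.Properties as Product
open import Data.Sum using (_⊎_; inj₁; inj₂)
open import Function using (_∘_)
open import Relation.Nullary using (Dec; yes; no; ¬?; contradiction)
open import Relation.Nullary.Decidable using (_×-dec_; _⊎-dec_; _→-dec_; toWitness)
open import Relation.Unary using (Decidable; _⊆_)
open import Relation.Binary.PropositionalEquality
  using (_≢_; refl; sym; trans; cong; subst; subst₂; module ≡-Reasoning)

module _ {A : Set} {f : A → A} where

  iter-+ : ∀ m n x → iter f (m + n) x ≡ iter f m (iter f n x)
  iter-+ zero    n x = refl
  iter-+ (suc m) n x = cong f (iter-+ m n x)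

  iter-injective : (∀ x y → f x ≡ f y → x ≡ y) → ∀ n {x y} → iter f n x ≡ iter f n y → x ≡ y
  iter-injective f-inj zero    eq = eq
  iter-injective f-inj (suc n) eq = iter-injective f-inj n (f-inj _ _ eq)

  iter-*-period : ∀ {m x} → iter f m x ≡ x → ∀ q → iter f (q * m) x ≡ x
  iter-*-period         period zero    = refl
  iter-*-period {m} {x} period (suc q) = begin
    iter f (m + q * m) x        ≡⟨ iter-+ m (q * m) x ⟩
    iter f m (iter f (q * m) x) ≡⟨ cong (iter f m) (iter-*-period period q) ⟩
    iter f m x                  ≡⟨ period ⟩
    x                           ∎
    where open ≡-Reasoning

  iter-% : ∀ {m x} .{{_ : NonZero m}} → iter f m x ≡ x → ∀ n → iter f (n % m) x ≡ iter f n x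
  iter-% {m} {x} period n = begin
    iter f (n % m) x                      ≡⟨ cong (iter f (n % m)) (iter-*-period period (n / m)) ⟨
    iter f (n % m) (iter f (n / m * m) x) ≡⟨ iter-+ (n % m) (n / m * m) x ⟨
    iter f (n % m + n / m * m) x          ≡⟨ cong (λ k → iter f k x) (m≡m%n+[m/n]*n n m) ⟨
    iter f n x                            ∎
    where open ≡-Reasoning

  iter-repeat⇒period : (∀ x y → f x ≡ f y → x ≡ y) → ∀ i n {x} →
                       iter f i x ≡ iter f (i + suc n) x → iter f (suc n) x ≡ x
  iter-repeat⇒period f-inj i n {x} eq =
    sym (iter-injective f-inj i (trans eq (iter-+ i (suc n) x)))

next : ∀ {n} → Fin (suc n) → Fin (suc n)
next {n} i = suc (toℕ i) mod suc n

CyclicallyConsecutivePair : ∀ {n} → (Fin 4 → Fin (suc n)) → Set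
CyclicallyConsecutivePair q = ∃[ a ] ∃[ b ] (a ≢ b × next (q a) ≡ q b)

cyclicallyConsecutivePair? : ∀ {n} (q : Fin 4 → Fin (suc n)) → Dec (CyclicallyConsecutivePair q)
cyclicallyConsecutivePair? q = any? λ a → any? λ b → ¬? (a ≟ b) ×-dec (next (q a) ≟ q b)

FourPointsOnCycle : ℕ → Set
FourPointsOnCycle n = ∀ (x y z w : Fin (suc n)) → let q = x ◂ y ◂ z ◂ w ◂ ∅ in
  (∀ a b → q a ≡ q b → a ≡ b) → CyclicallyConsecutivePair q

four-points-on-cycles-up-to-7 : ∀ (n : Fin 7) → FourPointsOnCycle (toℕ n)
four-points-on-cycles-up-to-7 = toWitness {a? = all? λ n →
  all? λ x → all? λ y → all? λ z → all? λ w → let q = x ◂ y ◂ z ◂ w ◂ ∅ in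
  (all? λ a → all? λ b → (q a ≟ q b) →-dec (a ≟ b)) →-dec cyclicallyConsecutivePair? q} _

four-points-on-short-cycle : ∀ {n} → n ℕ.< 7 → (q : Fin 4 → Fin (suc n)) →
                             (∀ a b → q a ≡ q b → a ≡ b) → CyclicallyConsecutivePair q
four-points-on-short-cycle {n} n<7 q q-inj =
  from-tuple (check (q zero) (q (# 1)) (q (# 2)) (q (# 3)) tuple-inj)
  where
  check : FourPointsOnCycle n
  check = subst FourPointsOnCycle (toℕ-fromℕ< n<7) (four-points-on-cycles-up-to-7 (Fin.fromℕ< n<7))
  tuple : Fin 4 → Fin (suc n)
  tuple = q zero ◂ q (# 1) ◂ q (# 2) ◂ q (# 3) ◂ ∅
  tuple≗q : ∀ a → tuple a ≡ q a
  tuple≗q zero                   = refl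
  tuple≗q (suc zero)             = refl
  tuple≗q (suc (suc zero))       = refl
  tuple≗q (suc (suc (suc zero))) = refl
  tuple-inj : ∀ a b → tuple a ≡ tuple b → a ≡ b
  tuple-inj a b eq = q-inj a b (trans (sym (tuple≗q a)) (trans eq (tuple≗q b)))
  from-tuple : CyclicallyConsecutivePair tuple → CyclicallyConsecutivePair q
  from-tuple (a , b , a≢b , consecutive) =
    a , b , a≢b , trans (cong next (sym (tuple≗q a))) (trans consecutive (tuple≗q b))

module _ (G : SimplePlaneTriangulation) where

  Dart : Set
  Dart = Fin (nD G)

  head : Dart → Vertex G
  head d = tail G (α G d)

  Adjacent-sym : ∀ {u v} → Adjacent G u v → Adjacent G v u
  Adjacent-sym (d , tail≡u , head≡v) =
    α G d , head≡v , trans (cong (tail G) (α-involution G d)) tail≡u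

  -- α d, σ d and σ (α (σ d)) are the darts of one triangular face; the last runs from
  -- head (σ d) to head d.
  head-σ-adjacent : ∀ d → Adjacent G (head (σ G d)) (head d)
  head-σ-adjacent d = third , σ-tail G _ , (begin
      tail G (α G third)                                  ≡⟨ σ-tail G (α G third) ⟨
      tail G (σ G (α G third))                            ≡⟨ cong face-end (α-involution G d) ⟨
      tail G (σ G (α G (σ G (α G (σ G (α G (α G d))))))) ≡⟨ cong (tail G) (face-3 G (α G d)) ⟩
      head d                                              ∎)
    where
    open ≡-Reasoning
    third : Dart
    third = σ G (α G (σ G d))
    face-end : Dart → Vertex G
    face-end d′ = tail G (σ G (α G (σ G (α G (σ G d′)))))

  iter-σ-tail : ∀ n d → tail G (iter (σ G) n d) ≡ tail G d
  iter-σ-tail zero    d = refl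
  iter-σ-tail (suc n) d = trans (σ-tail G _) (iter-σ-tail n d)

  iter-σ-collision : ∀ {b} e → deg G (tail G e) ℕ.≤ b →
                     ∃[ i ] ∃[ j ] (i ℕ.< j × j ℕ.≤ b × iter (σ G) i e ≡ iter (σ G) j e)
  iter-σ-collision {b} e deg≤b = collide (pigeonhole (s≤s deg≤b) position)
    where
    darts-at-e : List Dart
    darts-at-e = filter (λ d → tail G d ≟ tail G e) (allFin (nD G))
    at-e : ∀ k → iter (σ G) k e ∈ darts-at-e
    at-e k = ∈-filter⁺ _ (∈-allFin _) (iter-σ-tail k e)
    position : Fin (suc b) → Fin (deg G (tail G e))
    position k = index (at-e (toℕ k))
    collide : ∃[ i ] ∃[ j ] (i Fin.< j × position i ≡ position j) →
              ∃[ i ] ∃[ j ] (i ℕ.< j × j ℕ.≤ b × iter (σ G) i e ≡ iter (σ G) j e)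
    collide (i , j , i<j , same-position) = toℕ i , toℕ j , i<j , ℕ.≤-pred (toℕ<n j) , (begin
      iter (σ G) (toℕ i) e            ≡⟨ lookup-index (at-e (toℕ i)) ⟩
      lookup darts-at-e (position i)  ≡⟨ cong (lookup darts-at-e) same-position ⟩
      lookup darts-at-e (position j)  ≡⟨ lookup-index (at-e (toℕ j)) ⟨
      iter (σ G) (toℕ j) e            ∎)
      where open ≡-Reasoning

  σ-period : ∀ {b} e → deg G (tail G e) ℕ.≤ b →
             ∃[ n ] (suc n ℕ.≤ b × iter (σ G) (suc n) e ≡ e)
  σ-period e deg≤b
    with i , j , i<j , j≤b , same-dart ← iter-σ-collision e deg≤b
    with n , refl ← ℕ.m≤n⇒∃[o]m+o≡n i<j
    = n , ℕ.≤-trans (s≤s (ℕ.m≤n+m n i)) j≤b ,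
      iter-repeat⇒period (σ-injective G) i n
        (trans same-dart (cong (λ k → iter (σ G) k e) (sym (ℕ.+-suc i n))))

  module Rotation (e : Dart) {n} (period : iter (σ G) (suc n) e ≡ e) where

    dart : Fin (suc n) → Dart
    dart i = iter (σ G) (toℕ i) e

    dart-mod : ∀ k → dart (k mod suc n) ≡ iter (σ G) k e
    dart-mod k =
      trans (cong (λ m → iter (σ G) m e) (toℕ-fromℕ< (m%n<n k (suc n)))) (iter-% period k)

    σ-dart : ∀ i → σ G (dart i) ≡ dart (next i)
    σ-dart i = sym (dart-mod (suc (toℕ i)))

    dart-onto : ∀ d → tail G d ≡ tail G e → ∃[ i ] dart i ≡ d
    dart-onto d d-at-e with k , σᵏe≡d ← σ-cyclic G e d (sym d-at-e) =
      k mod suc n , trans (dart-mod k) σᵏe≡d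

    consecutive-among-four : n ℕ.< 7 → (E : Fin 4 → Dart) → (∀ a → tail G (E a) ≡ tail G e) →
                             (∀ a b → E a ≡ E b → a ≡ b) →
                             ∃[ a ] ∃[ b ] (a ≢ b × σ G (E a) ≡ E b)
    consecutive-among-four n<7 E at-e E-inj =
      link (four-points-on-short-cycle n<7 position position-inj)
      where
      position : Fin 4 → Fin (suc n)
      position a = dart-onto (E a) (at-e a) .proj₁
      dart-position : ∀ a → dart (position a) ≡ E a
      dart-position a = dart-onto (E a) (at-e a) .proj₂
      position-inj : ∀ a b → position a ≡ position b → a ≡ b
      position-inj a b eq =
        E-inj a b (trans (sym (dart-position a)) (trans (cong dart eq) (dart-position b)))
      link : CyclicallyConsecutivePair position → ∃[ a ] ∃[ b ] (a ≢ b × σ G (E a) ≡ E b)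
      link (a , b , a≢b , consecutive) = a , b , a≢b , (begin
        σ G (E a)                ≡⟨ cong (σ G) (dart-position a) ⟨
        σ G (dart (position a))  ≡⟨ σ-dart (position a) ⟩
        dart (next (position a)) ≡⟨ cong dart consecutive ⟩
        dart (position b)        ≡⟨ dart-position b ⟩
        E b                      ∎)
        where open ≡-Reasoning

  σ-links-two-of-four : ∀ {v} → deg G v ℕ.≤ 7 → (E : Fin 4 → Dart) → (∀ a → tail G (E a) ≡ v) →
                        (∀ a b → E a ≡ E b → a ≡ b) → ∃[ a ] ∃[ b ] (a ≢ b × σ G (E a) ≡ E b)
  σ-links-two-of-four deg≤7 E at-v E-inj
    with n , n<7 , period ← σ-period (E zero) (subst (λ w → deg G w ℕ.≤ 7) (sym (at-v zero)) deg≤7)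
    = Rotation.consecutive-among-four (E zero) period n<7 E
        (λ a → trans (at-v a) (sym (at-v zero))) E-inj

  two-of-four-neighbours-adjacent : ∀ {v} → deg G v ℕ.≤ 7 → (u : Fin 4 → Vertex G) →
                                    (∀ a b → u a ≡ u b → a ≡ b) → (∀ a → Adjacent G v (u a)) →
                                    ∃[ a ] ∃[ b ] (a ≢ b × Adjacent G (u a) (u b))
  two-of-four-neighbours-adjacent {v} deg≤7 u u-inj v~u =
    let a , b , a≢b , σEa≡Eb = σ-links-two-of-four deg≤7 E tail-E E-inj
    in b , a , a≢b ∘ sym ,
       subst₂ (Adjacent G) (trans (cong head σEa≡Eb) (head-E b)) (head-E a) (head-σ-adjacent (E a))
    where
    E : Fin 4 → Dart
    E a = v~u a .proj₁
    tail-E : ∀ a → tail G (E a) ≡ v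
    tail-E a = v~u a .proj₂ .proj₁
    head-E : ∀ a → head (E a) ≡ u a
    head-E a = v~u a .proj₂ .proj₂
    E-inj : ∀ a b → E a ≡ E b → a ≡ b
    E-inj a b eq = u-inj a b (trans (sym (head-E a)) (trans (cong head eq) (head-E b)))

module _ {k : ℕ} (A : Fin k → Fin k → Set) (A? : ∀ u v → Dec (A u v)) where
  open Data.List.Membership.DecPropositional (_≟_ {k}) using (_∈?_)

  δᵢ : (dG : Fin k → ℕ) (vs : List (Fin k)) → Fin (length vs) → Fin k → ℤ
  δᵢ dG vs i w = + dG w - [ A? w (lookup vs i) ] - [ w ∈? take (toℕ i) vs ]

  δ* : (dG : Fin k → ℕ) (vs : List (Fin k)) → Fin k → ℤ
  δ* dG vs w = + dG w - [ w ∈? vs ]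

count-mono : ∀ {A : Set} {P Q : A → Set} (P? : Decidable P) (Q? : Decidable Q) →
             P ⊆ Q → ∀ xs → length (filter P? xs) ℕ.≤ length (filter Q? xs)
count-mono P? Q? P⊆Q xs = length-mono-≤ (filter⁺ P? Q? (λ { refl → P⊆Q }) (⊆-refl {x = xs}))

iverson-mono : ∀ {P Q : Set} → (P → Q) → (P? : Dec P) (Q? : Dec Q) → [ P? ] ℤ.≤ [ Q? ]
iverson-mono P⇒Q (yes p) (yes _) = ℤ.≤-refl
iverson-mono P⇒Q (yes p) (no ¬q) = contradiction (P⇒Q p) ¬q
iverson-mono P⇒Q (no _)  (yes _) = +≤+ ℕ.z≤n
iverson-mono P⇒Q (no _)  (no _)  = ℤ.≤-refl

module _ {k : ℕ} {A B : Fin k → Fin k → Set}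
         (A? : ∀ u v → Dec (A u v)) (B? : ∀ u v → Dec (B u v))
         (A⇒B : ∀ u v → A u v → B u v) where
  open Data.List.Membership.DecPropositional (_≟_ {k}) using (_∈?_)

  zeroReducible-mono : ∀ {S δA δB} → (∀ w → δB w ℤ.≤ δA w) →
                       ZeroReducible A A? S δA → ZeroReducible B B? S δB
  zeroReducible-mono δB≤δA (ws , ws↭S , order) = ws , ws↭S , λ t →
    let w = lookup ws t
        earlier = take (toℕ t) ws
        more-earlier-neighbours = count-mono (λ u → A? u w) (λ u → B? u w) (A⇒B _ w) earlier
    in ℤ.≤-trans (ℤ.+-mono-≤ (δB≤δA w) (ℤ.neg-mono-≤ (+≤+ more-earlier-neighbours))) (order t)

  degH-mono : ∀ u → degH A A? u ℕ.≤ degH B B? u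
  degH-mono u = count-mono (A? u) (B? u) (A⇒B u _) (allFin k)

  oneSixthReducible-mono : ∀ {dA dB} → (∀ w → dB w ℕ.≤ dA w) →
                           OneSixthReducible A A? dA → OneSixthReducible B B? dB
  oneSixthReducible-mono {dA} {dB} dB≤dA (vs , unique , removals , final) =
    vs , unique ,
    (λ i guard → zeroReducible-mono (δᵢ-mono i) (removals i (guard-mono guard))) ,
    (λ guard → zeroReducible-mono δ*-mono (final (guard-mono guard)))
    where
    guard-mono : ∀ {xs} → All (λ u → degH B B? u ℕ.< dB u) xs →
                          All (λ u → degH A A? u ℕ.< dA u) xs
    guard-mono = All.map λ {u} lt → ℕ.≤-<-trans (degH-mono u) (ℕ.<-≤-trans lt (dB≤dA u))
    δᵢ-mono : ∀ i w → δᵢ B B? dB vs i w ℤ.≤ δᵢ A A? dA vs i w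
    δᵢ-mono i w = ℤ.+-monoˡ-≤ _ (ℤ.+-mono-≤ (+≤+ (dB≤dA w)) (ℤ.neg-mono-≤ more-neighbours))
      where
      c : Fin k
      c = lookup vs i
      more-neighbours : [ A? w c ] ℤ.≤ [ B? w c ]
      more-neighbours = iverson-mono (A⇒B w c) (A? w c) (B? w c)
    δ*-mono : ∀ w → δ* B B? dB vs w ℤ.≤ δ* A A? dA vs w
    δ*-mono w = ℤ.+-monoˡ-≤ (- [ w ∈? vs ]) (+≤+ (dB≤dA w))

module _ {k : ℕ} (A : Fin k → Fin k → Set) (A? : ∀ u v → Dec (A u v)) where
  open Data.List.Sort.InsertionSort.Base (≤-decTotalOrder k) using (sort)
  open Data.List.Sort.InsertionSort.Properties (≤-decTotalOrder k) using (sort-↭)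

  ZeroReducingOrder : (Fin k → ℤ) → List (Fin k) → Set
  ZeroReducingOrder δ ws = ∀ t → let w = lookup ws t in
    δ w - + length (filter (λ u → A? u w) (take (toℕ t) ws)) ℤ.≤ + 4

  ZeroReducibleBy : List (Fin k) → (Fin k → ℤ) → List (Fin k) → Set
  ZeroReducibleBy S δ ws = sort ws ≡ sort S × ZeroReducingOrder δ ws

  zeroReducibleBy? : ∀ S δ ws → Dec (ZeroReducibleBy S δ ws)
  zeroReducibleBy? S δ ws = ≡-dec _≟_ (sort ws) (sort S) ×-dec all? (λ _ → _ ℤ.≤? _)

  zeroReducibleBy⇒zeroReducible : ∀ S δ ws → ZeroReducibleBy S δ ws → ZeroReducible A A? S δ
  zeroReducibleBy⇒zeroReducible S δ ws (same-sort , order) =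
    ws , ↭-trans (↭-sym (sort-↭ ws)) (↭-trans (↭-reflexive same-sort) (sort-↭ S)) , order

  OneSixthCertificate : (dG : Fin k → ℕ) (vs : List (Fin k)) →
                        (Fin (length vs) → List (Fin k)) → List (Fin k) → Set
  OneSixthCertificate dG vs orders final =
    Unique vs ×
    (∀ i → ZeroReducibleBy (allV-minus A A? (lookup vs i)) (δᵢ A A? dG vs i) (orders i)) ×
    ZeroReducibleBy (allV A A?) (δ* A A? dG vs) final

  oneSixthCertificate? : ∀ dG vs orders final → Dec (OneSixthCertificate dG vs orders final)
  oneSixthCertificate? dG vs orders final =
    UniqueDec.unique? _≟_ vs ×-dec
    all? (λ i → zeroReducibleBy? (allV-minus A A? (lookup vs i)) (δᵢ A A? dG vs i) (orders i)) ×-dec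
    zeroReducibleBy? (allV A A?) (δ* A A? dG vs) final

  -- The certificate gives 0-reducibility outright.
  oneSixthCertificate⇒oneSixthReducible : ∀ dG vs orders final →
    OneSixthCertificate dG vs orders final → OneSixthReducible A A? dG
  oneSixthCertificate⇒oneSixthReducible dG vs orders final (unique , removals , after) =
    vs , unique ,
    (λ i _ → zeroReducibleBy⇒zeroReducible _ (δᵢ A A? dG vs i) (orders i) (removals i)) ,
    (λ _ → zeroReducibleBy⇒zeroReducible _ (δ* A A? dG vs) final after)

module _ {k : ℕ} where
  open Data.List.Membership.DecPropositional (Product.≡-dec (_≟_ {k}) (_≟_ {k}))
    using () renaming (_∈?_ to _∈²?_)

  EdgeIn : List (Fin k × Fin k) → Fin k → Fin k → Set
  EdgeIn es u v = (u , v) ∈ es ⊎ (v , u) ∈ es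

  edgeIn? : ∀ es u v → Dec (EdgeIn es u v)
  edgeIn? es u v = ((u , v) ∈²? es) ⊎-dec ((v , u) ∈²? es)

  edgeIn⇒ : ∀ {A : Fin k → Fin k → Set} {es} → (∀ {u v} → A u v → A v u) →
            All (uncurry A) es → ∀ u v → EdgeIn es u v → A u v
  edgeIn⇒ A-sym A-es u v (inj₁ uv∈es) = All.lookup A-es uv∈es
  edgeIn⇒ A-sym A-es u v (inj₂ vu∈es) = A-sym (All.lookup A-es vu∈es)

forcedEdges : Fin 6 → Fin 6 → List (Fin 6 × Fin 6)
forcedEdges x y = (x , y) ∷ (# 0 , # 1) ∷ (# 0 , # 2) ∷ (# 0 , # 3) ∷ (# 0 , # 4) ∷ (# 0 , # 5) ∷
                  (# 1 , # 2) ∷ (# 1 , # 3) ∷ []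

Forced : Fin 6 → Fin 6 → Fin 6 → Fin 6 → Set
Forced x y = EdgeIn (forcedEdges x y)

forced? : ∀ x y u v → Dec (Forced x y u v)
forced? x y = edgeIn? (forcedEdges x y)

degrees : Fin 6 → ℕ
degrees zero       = 7
degrees (suc zero) = 8
degrees _          = 5

module _ (x y : Fin 6) where
  open Data.List.Membership.DecPropositional (_≟_ {6}) using (_∈?_)

  others : List (Fin 6)
  others = filter (λ w → ¬? (w ∈? (# 0 ∷ # 1 ∷ x ∷ y ∷ []))) (allFin 6)

  removed : List (Fin 6)
  removed = # 1 ∷ # 0 ∷ x ∷ []

  removalOrders : Fin (length removed) → List (Fin 6)
  removalOrders = lookup ((# 2 ∷ # 3 ∷ # 0 ∷ # 4 ∷ # 5 ∷ []) ∷
                          (# 2 ∷ # 3 ∷ # 1 ∷ # 4 ∷ # 5 ∷ []) ∷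
                          (y ∷ # 0 ∷ others ++ # 1 ∷ []) ∷ [])

  finalOrder : List (Fin 6)
  finalOrder = x ∷ y ∷ # 0 ∷ others ++ # 1 ∷ []

forced-oneSixthCertificate : ∀ a b → a ≢ b → let x = 2 ↑ʳ a; y = 2 ↑ʳ b in
  OneSixthCertificate (Forced x y) (forced? x y) degrees
                      (removed x y) (removalOrders x y) (finalOrder x y)
forced-oneSixthCertificate = toWitness {a? = all? λ a → all? λ b → ¬? (a ≟ b) →-dec
  let x = 2 ↑ʳ a; y = 2 ↑ʳ b in
  oneSixthCertificate? (Forced x y) (forced? x y) degrees
                       (removed x y) (removalOrders x y) (finalOrder x y)} _

forced-oneSixthReducible : ∀ a b → a ≢ b →
  OneSixthReducible (Forced (2 ↑ʳ a) (2 ↑ʳ b)) (forced? (2 ↑ʳ a) (2 ↑ʳ b)) degrees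
forced-oneSixthReducible a b a≢b =
  oneSixthCertificate⇒oneSixthReducible (Forced x y) (forced? x y) degrees
    (removed x y) (removalOrders x y) (finalOrder x y) (forced-oneSixthCertificate a b a≢b)
  where
  x y : Fin 6
  x = 2 ↑ʳ a
  y = 2 ↑ʳ b

lemma3p6 : (G : SimplePlaneTriangulation) (v : Fin 6 → Vertex G) →
           (∀ i j → v i ≡ v j → i ≡ j) →
           deg G (v (# 0)) ≡ 7 → deg G (v (# 1)) ≡ 8 →
           deg G (v (# 2)) ≡ 5 → deg G (v (# 3)) ≡ 5 →
           deg G (v (# 4)) ≡ 5 → deg G (v (# 5)) ≡ 5 →
           Adjacent G (v (# 0)) (v (# 1)) → Adjacent G (v (# 0)) (v (# 2)) →
           Adjacent G (v (# 0)) (v (# 3)) → Adjacent G (v (# 0)) (v (# 4)) →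
           Adjacent G (v (# 0)) (v (# 5)) →
           Adjacent G (v (# 1)) (v (# 2)) → Adjacent G (v (# 1)) (v (# 3)) →
           InducedConfigurationOneSixthReducible G v
lemma3p6 G v v-inj d₁ d₂ d₃ d₄ d₅ d₆ v₁v₂ v₁v₃ v₁v₄ v₁v₅ v₁v₆ v₂v₃ v₂v₄ =
  let a , b , a≢b , xy = two-of-four-neighbours-adjacent G (ℕ.≤-reflexive d₁) (v ∘ (2 ↑ʳ_))
                           (λ a b → ↑ʳ-injective 2 a b ∘ v-inj _ _) v₁-adjacent
      forced⇒adjacent = edgeIn⇒ (Adjacent-sym G)
                          (xy ∷ v₁v₂ ∷ v₁v₃ ∷ v₁v₄ ∷ v₁v₅ ∷ v₁v₆ ∷ v₂v₃ ∷ v₂v₄ ∷ [])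
  in oneSixthReducible-mono (forced? (2 ↑ʳ a) (2 ↑ʳ b)) (λ i j → adjacent? G (v i) (v j))
       forced⇒adjacent (ℕ.≤-reflexive ∘ degree) (forced-oneSixthReducible a b a≢b)
  where
  v₁-adjacent : ∀ a → Adjacent G (v (# 0)) (v (2 ↑ʳ a))
  v₁-adjacent zero                   = v₁v₃
  v₁-adjacent (suc zero)             = v₁v₄
  v₁-adjacent (suc (suc zero))       = v₁v₅
  v₁-adjacent (suc (suc (suc zero))) = v₁v₆
  degree : ∀ w → deg G (v w) ≡ degrees w
  degree zero                               = d₁
  degree (suc zero)                         = d₂
  degree (suc (suc zero))                   = d₃
  degree (suc (suc (suc zero)))             = d₄
  degree (suc (suc (suc (suc zero))))       = d₅
  degree (suc (suc (suc (suc (suc zero))))) = d₆
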